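{- If $G'\in Expand(G)$ and $H'\in Expand(H)$, then $\alpha^*(G'|H)\le \alpha^*(G|H)\le \alpha^*(G|H')$.
   Context: All graphs are finite, simple, undirected; $\boxtimes$ is the strong product; $\alpha^*(G|H)=\sup_W\frac{\alpha(G\boxtimes W)}{\alpha(H\boxtimes W)}$ over all graphs $W$. For a graph $K$, $Expand(K)$ is the set of all graphs obtainable from $K$ by a finite sequence of the operations: (I) remove a vertex; (II) replace a vertex $v$ by a clique of arbitrary size, each new vertex joined to all neighbors of $v$; (III) add a new edge. -}

module Defs where

open import Data.Nat using (ℕ; zero; suc; _+_; _*_; _<_; _⊔_)
open import Data.Bool using (Bool; true; false; _∧_; _∨_; not; if_then_else_)
open import Data.Bool.Properties using (∨-comm; ∧-comm)
open import Data.Fin using (Fin; zero; suc; _≟_; splitAt; remQuot; punchIn)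
open import Data.Fin.Subset using (Subset; ∣_∣)
open import Data.Fin.Permutation using (Permutation′; _⟨$⟩ʳ_)
open import Data.Vec using (Vec; []; _∷_; lookup)
open import Data.List using (List; []; _∷_; _++_; map; foldr; allFin)
open import Data.Bool.ListAction using (and)
open import Data.Product using (_×_; _,_; proj₁; proj₂; ∃)
open import Data.Sum using ([_,_])
open import Relation.Nullary using (does; yes; no)
open import Relation.Binary.PropositionalEquality using (_≡_; refl; sym; cong₂; trans)

record Graph : Set where
  field
    n      : ℕ
    adj    : Fin n → Fin n → Bool
    adj-sym : ∀ i j → adj i j ≡ adj j i
    irrefl : ∀ i → adj i i ≡ false

open Graph

_==_ : ∀ {n} → Fin n → Fin n → Bool
i == j = does (i ≟ j)

==-sym : ∀ {n} (i j : Fin n) → (i == j) ≡ (j == i)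
==-sym i j with i ≟ j | j ≟ i
... | yes _ | yes _ = refl
... | no _  | no _  = refl
... | yes p | no q  with q (sym p)
...   | ()
==-sym i j | no p | yes q with p (sym q)
...   | ()

==-refl : ∀ {n} (i : Fin n) → (i == i) ≡ true
==-refl i with i ≟ i
... | yes _ = refl
... | no p with p refl
...   | ()

mkGraph : (m : ℕ) (R : Fin m → Fin m → Bool) → (∀ i j → R i j ≡ R j i) → Graph
mkGraph m R Rs = record
  { n = m
  ; adj = λ i j → not (i == j) ∧ R i j
  ; adj-sym = λ i j → cong₂ (λ a b → not a ∧ b) (==-sym i j) (Rs i j)
  ; irrefl = λ i → helper i
  }
  where
  helper : ∀ i → (not (i == i) ∧ R i i) ≡ false
  helper i rewrite ==-refl i = refl

closedAdj : (G : Graph) → Fin (n G) → Fin (n G) → Bool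
closedAdj G a c = (a == c) ∨ adj G a c

closedAdj-sym : (G : Graph) → ∀ a c → closedAdj G a c ≡ closedAdj G c a
closedAdj-sym G a c = cong₂ _∨_ (==-sym a c) (adj-sym G a c)

_⊠_ : Graph → Graph → Graph
G ⊠ W = mkGraph (n G * n W) R Rs
  where
  fst : Fin (n G * n W) → Fin (n G)
  fst x = proj₁ (remQuot {n G} (n W) x)
  snd : Fin (n G * n W) → Fin (n W)
  snd x = proj₂ (remQuot {n G} (n W) x)
  R : Fin (n G * n W) → Fin (n G * n W) → Bool
  R x y = closedAdj G (fst x) (fst y) ∧ closedAdj W (snd x) (snd y)
  Rs : ∀ x y → R x y ≡ R y x
  Rs x y = cong₂ _∧_ (closedAdj-sym G (fst x) (fst y)) (closedAdj-sym W (snd x) (snd y))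

allSubsets : ∀ m → List (Subset m)
allSubsets zero    = [] ∷ []
allSubsets (suc m) = map (true ∷_) (allSubsets m) ++ map (false ∷_) (allSubsets m)

isIndependent : (G : Graph) → Subset (n G) → Bool
isIndependent G s =
  and (map (λ i → and (map (λ j → not (lookup s i ∧ lookup s j ∧ adj G i j))
                           (allFin (n G))))
           (allFin (n G)))

α : Graph → ℕ
α G = foldr _⊔_ 0
        (map (λ s → if isIndependent G s then ∣ s ∣ else 0) (allSubsets (n G)))

removeVertex : (G : Graph) → Fin (n G) → Graph
removeVertex record { n = zero } ()
removeVertex record { n = suc m ; adj = a ; adj-sym = s } v =
  mkGraph m (λ i j → a (punchIn v i) (punchIn v j))
            (λ i j → s (punchIn v i) (punchIn v j))

-- (II) replace vertex v by a clique of size (k + 1): v together with k new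
-- vertices; the clique is complete and each new vertex is joined to all
-- neighbours of v.  (A clique of size 0 is vertex removal, operation (I).)
blowUp : (G : Graph) → Fin (n G) → ℕ → Graph
blowUp G v k = mkGraph (n G + k) R Rs
  where
  f : Fin (n G + k) → Fin (n G)
  f x = [ (λ i → i) , (λ _ → v) ] (splitAt (n G) x)
  R : Fin (n G + k) → Fin (n G + k) → Bool
  R x y = closedAdj G (f x) (f y)
  Rs : ∀ x y → R x y ≡ R y x
  Rs x y = closedAdj-sym G (f x) (f y)

-- (III) add the edge {a, b} (a no-op if a = b or it is already present)
addEdge : (G : Graph) → Fin (n G) → Fin (n G) → Graph
addEdge G a b = mkGraph (n G) R Rs
  where
  P : Fin (n G) → Fin (n G) → Bool
  P i j = (i == a) ∧ (j == b)
  R : Fin (n G) → Fin (n G) → Bool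
  R i j = adj G i j ∨ (P i j ∨ P j i)
  Rs : ∀ i j → R i j ≡ R j i
  Rs i j = cong₂ _∨_ (adj-sym G i j) (∨-comm (P i j) (P j i))

-- relabel the vertices by a permutation (graphs are taken up to isomorphism)
relabel : (G : Graph) → Permutation′ (n G) → Graph
relabel G π = mkGraph (n G) (λ i j → adj G (π ⟨$⟩ʳ i) (π ⟨$⟩ʳ j))
                            (λ i j → adj-sym G (π ⟨$⟩ʳ i) (π ⟨$⟩ʳ j))

-- Expand K G : G ∈ Expand(K)
data Expand (K : Graph) : Graph → Set where
  here    : Expand K K
  remove  : ∀ {G} → Expand K G → (v : Fin (n G)) → Expand K (removeVertex G v)
  clique  : ∀ {G} → Expand K G → (v : Fin (n G)) (k : ℕ) → Expand K (blowUp G v k)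
  edge    : ∀ {G} → Expand K G → (a b : Fin (n G)) → Expand K (addEdge G a b)
  iso     : ∀ {G} → Expand K G → (π : Permutation′ (n G)) → Expand K (relabel G π)

-- α*(A|B) = sup_W α(A ⊠ W) / α(B ⊠ W), valued in [0, ∞].
-- RatioAbove A B W p q : the ratio α(A⊠W)/α(B⊠W) exceeds p/(q+1), i.e.
-- p · α(B⊠W) < α(A⊠W) · (q+1)  (so x/0 = ∞ for x > 0, and 0/0 exceeds nothing).

RatioAbove : Graph → Graph → Graph → ℕ → ℕ → Set
RatioAbove A B W p q = p * α (B ⊠ W) < α (A ⊠ W) * suc q

-- α*(A|B) ≤ α*(C|D): every nonnegative rational strictly below some ratio
-- for (A|B) is strictly below some ratio for (C|D).
AlphaStarLe : Graph → Graph → Graph → Graph → Set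
AlphaStarLe A B C D =
  ∀ (W : Graph) (p q : ℕ) → RatioAbove A B W p q → ∃ λ W′ → RatioAbove C D W′ p q

-- Every Expand step from K to G comes with a map V(G) → V(K) that reflects "equal or adjacent",
-- i.e. a homomorphism between the complements.  Such maps compose, and they survive taking the
-- strong product with any W (acting as the identity on W).  A complement homomorphism is injective
-- on an independent set and maps it onto an independent set, so α(G ⊠ W) ≤ α(K ⊠ W) for every W.
-- Hence each ratio α(G′ ⊠ W)/α(H ⊠ W) is at most α(G ⊠ W)/α(H ⊠ W), which in turn is at most
-- α(G ⊠ W)/α(H′ ⊠ W), for the same W.
{-# OPTIONS --safe #-}
module Submission where

open import Defs
open import Data.Product using (_×_; _,_; proj₁; proj₂; ∃)

open Graph
open import Data.Bool using (Bool; true; false; T; not; _∧_; if_then_else_)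
open import Data.Bool.ListAction using (all)
open import Data.Bool.Properties using (T-∧; T-∨; T-≡; T-not-≡)
open import Data.Empty using (⊥-elim)
open import Data.Fin using (Fin; zero; suc; _≟_; splitAt; remQuot; combine; punchIn)
open import Data.Fin.Properties using (remQuot-combine; punchIn-injective; suc-injective; 0≢1+n)
open import Data.Fin.Permutation using (Permutation′; _⟨$⟩ʳ_)
open import Data.Fin.Subset using (Subset; ∣_∣; _∈_; _∪_; ⁅_⁆; ⊥; _-_; inside; outside)
open import Data.Fin.Subset.Properties
  using (x∈p∪q⁺; x∈p∪q⁻; x∈⁅x⁆; x∈⁅y⁆⇒x≡y; ∉⊥; x∈p∧x≢y⇒x∈p-y; x∈p⇒∣p-x∣<∣p∣)
open import Data.List using (List; map; allFin)
import Data.List.Membership.Propositional as List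
open import Data.List.Membership.Propositional.Properties using (∈-map⁺; ∈-++⁺ˡ; ∈-++⁺ʳ; ∈-allFin)
open import Data.List.Properties using (foldr-preservesᵇ; foldr-preservesᵒ)
import Data.List.Relation.Unary.All as All
import Data.List.Relation.Unary.All.Properties as All
import Data.List.Relation.Unary.Any as Any
import Data.List.Relation.Unary.Any.Properties as Any
open import Data.Nat using (ℕ; suc; _≤_; _⊔_; z≤n; s≤s)
open import Data.Nat.Properties
  using (≤-refl; ≤-trans; ⊔-lub; m≤m⊔n; m≤n⊔m; <-≤-trans; ≤-<-trans; *-monoˡ-≤; *-monoʳ-≤)
open import Data.Sum using (_⊎_; inj₁; inj₂; [_,_]; [_,_]′) renaming (map to ⊎-map)
open import Data.Vec using (_∷_; []; lookup; here; there)
open import Data.Vec.Properties using ([]=⇒lookup; lookup⇒[]=)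
open import Function using (_∘_; id; Equivalence; Injection)
open import Function.Properties.Inverse using (↔⇒↣)
open import Relation.Nullary using (¬_; yes; no)
open import Relation.Binary.PropositionalEquality using (_≡_; refl; sym; cong; subst; subst₂)

private
  variable
    m k : ℕ
    G K W : Graph

closedAdj-refl : (G : Graph) (x : Fin (n G)) → T (closedAdj G x x)
closedAdj-refl G x rewrite ==-refl x = _

adj⇒closedAdj : (G : Graph) {x y : Fin (n G)} → T (adj G x y) → T (closedAdj G x y)
adj⇒closedAdj G = Equivalence.from T-∨ ∘ inj₂

closedAdj⁻ : (G : Graph) {x y : Fin (n G)} → T (closedAdj G x y) → x ≡ y ⊎ T (adj G x y)
closedAdj⁻ G {x} {y} x~y with x ≟ y
... | yes x≡y = inj₁ x≡y
... | no _    = inj₂ x~y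

adj-irrefl : (G : Graph) {x y : Fin (n G)} → x ≡ y → ¬ T (adj G x y)
adj-irrefl G {x} refl = subst T (irrefl G x)

mkGraph-closedAdj⁺ : (R : Fin m → Fin m → Bool) (R-sym : ∀ i j → R i j ≡ R j i) {i j : Fin m} →
  T (R i j) → T (closedAdj (mkGraph m R R-sym) i j)
mkGraph-closedAdj⁺ R R-sym {i} {j} r with i ≟ j
... | yes _ = _
... | no _  = r

record ComplementHom (G K : Graph) : Set where
  field
    to        : Fin (n G) → Fin (n K)
    reflects  : ∀ {x y} → T (closedAdj K (to x) (to y)) → T (closedAdj G x y)

open ComplementHom

ComplementHom-refl : ComplementHom G G
ComplementHom-refl = record { to = id ; reflects = id }

ComplementHom-trans : ComplementHom G K → ComplementHom K W → ComplementHom G W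
ComplementHom-trans g h = record { to = to h ∘ to g ; reflects = reflects g ∘ reflects h }

mkGraph-complementHom : {R : Fin m → Fin m → Bool} {R-sym : ∀ i j → R i j ≡ R j i}
  (f : Fin m → Fin (n K)) →
  (∀ {i j} → T (closedAdj K (f i) (f j)) → i ≡ j ⊎ T (R i j)) →
  ComplementHom (mkGraph m R R-sym) K
mkGraph-complementHom {K = K} {R = R} {R-sym} f reflect = record { to = f ; reflects = reflects′ }
  where
  reflects′ : ∀ {i j} → T (closedAdj K (f i) (f j)) → T (closedAdj (mkGraph _ R R-sym) i j)
  reflects′ {i} {j} fi~fj with reflect fi~fj
  ... | inj₁ refl = closedAdj-refl (mkGraph _ R R-sym) i
  ... | inj₂ r    = mkGraph-closedAdj⁺ R R-sym r

removeVertex-complementHom : (G : Graph) (v : Fin (n G)) → ComplementHom (removeVertex G v) G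
removeVertex-complementHom G@record { n = suc _ } v =
  mkGraph-complementHom (punchIn v) (⊎-map (punchIn-injective v _ _) id ∘ closedAdj⁻ G)

blowUp-complementHom : (G : Graph) (v : Fin (n G)) (k : ℕ) → ComplementHom (blowUp G v k) G
blowUp-complementHom G v k = mkGraph-complementHom (λ x → [ id , (λ _ → v) ] (splitAt (n G) x)) inj₂

addEdge-complementHom : (G : Graph) (a b : Fin (n G)) → ComplementHom (addEdge G a b) G
addEdge-complementHom G a b =
  mkGraph-complementHom id (⊎-map id (Equivalence.from T-∨ ∘ inj₁) ∘ closedAdj⁻ G)

relabel-complementHom : (G : Graph) (π : Permutation′ (n G)) → ComplementHom (relabel G π) G
relabel-complementHom G π =
  mkGraph-complementHom (π ⟨$⟩ʳ_) (⊎-map (Injection.injective (↔⇒↣ π)) id ∘ closedAdj⁻ G)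

Expand⇒ComplementHom : Expand K G → ComplementHom G K
Expand⇒ComplementHom here           = ComplementHom-refl
Expand⇒ComplementHom (remove e v)   =
  ComplementHom-trans (removeVertex-complementHom _ v) (Expand⇒ComplementHom e)
Expand⇒ComplementHom (clique e v k) =
  ComplementHom-trans (blowUp-complementHom _ v k) (Expand⇒ComplementHom e)
Expand⇒ComplementHom (edge e a b)   =
  ComplementHom-trans (addEdge-complementHom _ a b) (Expand⇒ComplementHom e)
Expand⇒ComplementHom (iso e π)      =
  ComplementHom-trans (relabel-complementHom _ π) (Expand⇒ComplementHom e)

module _ (G W : Graph) where

  ⊠-fst : Fin (n (G ⊠ W)) → Fin (n G)
  ⊠-fst u = proj₁ (remQuot {n G} (n W) u)

  ⊠-snd : Fin (n (G ⊠ W)) → Fin (n W)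
  ⊠-snd u = proj₂ (remQuot {n G} (n W) u)

  ⊠-closedAdj⁻ : ∀ {u v} → T (closedAdj (G ⊠ W) u v) →
    T (closedAdj G (⊠-fst u) (⊠-fst v)) × T (closedAdj W (⊠-snd u) (⊠-snd v))
  ⊠-closedAdj⁻ {u} {v} u~v with u ≟ v
  ... | yes refl = closedAdj-refl G (⊠-fst u) , closedAdj-refl W (⊠-snd u)
  ... | no _     = Equivalence.to T-∧ u~v

⊠-complementHom : ComplementHom G K → (W : Graph) → ComplementHom (G ⊠ W) (K ⊠ W)
⊠-complementHom {G} {K} h W = mkGraph-complementHom f (inj₂ ∘ reflects-components)
  where
  f : Fin (n (G ⊠ W)) → Fin (n (K ⊠ W))
  f u = combine (to h (⊠-fst G W u)) (⊠-snd G W u)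

  fst-f : ∀ u → ⊠-fst K W (f u) ≡ to h (⊠-fst G W u)
  fst-f u = cong proj₁ (remQuot-combine (to h (⊠-fst G W u)) (⊠-snd G W u))

  snd-f : ∀ u → ⊠-snd K W (f u) ≡ ⊠-snd G W u
  snd-f u = cong proj₂ (remQuot-combine (to h (⊠-fst G W u)) (⊠-snd G W u))

  reflects-components : ∀ {u v} → T (closedAdj (K ⊠ W) (f u) (f v)) →
    T (closedAdj G (⊠-fst G W u) (⊠-fst G W v) ∧ closedAdj W (⊠-snd G W u) (⊠-snd G W v))
  reflects-components {u} {v} fu~fv with ⊠-closedAdj⁻ K W fu~fv
  ... | fst~ , snd~ = Equivalence.from T-∧
    ( reflects h (subst₂ (λ a b → T (closedAdj K a b)) (fst-f u) (fst-f v) fst~)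
    , subst₂ (λ a b → T (closedAdj W a b)) (snd-f u) (snd-f v) snd~ )

Independent : (G : Graph) → Subset (n G) → Set
Independent G p = ∀ {x y} → x ∈ p → y ∈ p → T (closedAdj G x y) → x ≡ y

T-not-∧³⁻ : ∀ {a b c} → a ≡ true → b ≡ true → T (not (a ∧ b ∧ c)) → ¬ T c
T-not-∧³⁻ refl refl ¬c = subst T (Equivalence.to T-not-≡ ¬c)

T-not-∧³⁺ : ∀ a b c → (a ≡ true → b ≡ true → ¬ T c) → T (not (a ∧ b ∧ c))
T-not-∧³⁺ false _     _     _ = _
T-not-∧³⁺ true  false _     _ = _
T-not-∧³⁺ true  true  false _ = _
T-not-∧³⁺ true  true  true  h = h refl refl _

edgeFreeAt : (G : Graph) → Subset (n G) → Fin (n G) → Fin (n G) → Bool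
edgeFreeAt G p x y = not (lookup p x ∧ lookup p y ∧ adj G x y)

isIndependent⇒edgeFreeAt : (G : Graph) (p : Subset (n G)) → T (isIndependent G p) →
  ∀ x y → T (edgeFreeAt G p x y)
isIndependent⇒edgeFreeAt G p ind x y =
  All.lookup (All.all⁺ (edgeFreeAt G p x) _ row-x) (∈-allFin y)
  where
  row-x : T (all (edgeFreeAt G p x) (allFin (n G)))
  row-x = All.lookup (All.all⁺ _ _ ind) (∈-allFin x)

edgeFreeAt⇒isIndependent : (G : Graph) (p : Subset (n G)) → (∀ x y → T (edgeFreeAt G p x y)) →
  T (isIndependent G p)
edgeFreeAt⇒isIndependent G p edgeFree =
  All.all⁻ row (All.universal (λ x → All.all⁻ (edgeFreeAt G p x) (All.universal (edgeFree x) vertices))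
                              vertices)
  where
  vertices : List (Fin (n G))
  vertices = allFin (n G)
  row : Fin (n G) → Bool
  row x = all (edgeFreeAt G p x) vertices

isIndependent⇒Independent : (G : Graph) (p : Subset (n G)) → T (isIndependent G p) → Independent G p
isIndependent⇒Independent G p ind {x} {y} x∈p y∈p x~y with closedAdj⁻ G x~y
... | inj₁ x≡y = x≡y
... | inj₂ xy  =
  ⊥-elim (T-not-∧³⁻ ([]=⇒lookup x∈p) ([]=⇒lookup y∈p) (isIndependent⇒edgeFreeAt G p ind x y) xy)

Independent⇒isIndependent : (G : Graph) (p : Subset (n G)) → Independent G p → T (isIndependent G p)
Independent⇒isIndependent G p ind = edgeFreeAt⇒isIndependent G p λ x y →
  T-not-∧³⁺ _ _ _ λ px py xy → adj-irrefl G (ind (lookup⇒[]= x p px) (lookup⇒[]= y p py) (adj⇒closedAdj G xy)) xy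

image : (Fin m → Fin k) → Subset m → Subset k
image f []            = ⊥
image f (inside ∷ p)  = ⁅ f zero ⁆ ∪ image (f ∘ suc) p
image f (outside ∷ p) = image (f ∘ suc) p

∈-image⁺ : (f : Fin m → Fin k) {p : Subset m} {x : Fin m} → x ∈ p → f x ∈ image f p
∈-image⁺ f {inside ∷ _}  here        = x∈p∪q⁺ (inj₁ (x∈⁅x⁆ (f zero)))
∈-image⁺ f {inside ∷ _}  (there x∈p) = x∈p∪q⁺ (inj₂ (∈-image⁺ (f ∘ suc) x∈p))
∈-image⁺ f {outside ∷ _} (there x∈p) = ∈-image⁺ (f ∘ suc) x∈p

∈-image⁻ : (f : Fin m → Fin k) (p : Subset m) {y : Fin k} → y ∈ image f p → ∃ λ x → x ∈ p × f x ≡ y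
∈-image⁻ f [] y∈ = ⊥-elim (∉⊥ y∈)
∈-image⁻ f (inside ∷ p) y∈ with x∈p∪q⁻ ⁅ f zero ⁆ (image (f ∘ suc) p) y∈
... | inj₁ y∈⁅f0⁆ = zero , here , sym (x∈⁅y⁆⇒x≡y (f zero) y∈⁅f0⁆)
... | inj₂ y∈img with ∈-image⁻ (f ∘ suc) p y∈img
...   | x , x∈p , fx≡y = suc x , there x∈p , fx≡y
∈-image⁻ f (outside ∷ p) y∈ with ∈-image⁻ (f ∘ suc) p y∈
... | x , x∈p , fx≡y = suc x , there x∈p , fx≡y

∣p∣≤∣q∣-injectiveOn : (f : Fin m → Fin k) {p : Subset m} {q : Subset k} →
  (∀ {x} → x ∈ p → f x ∈ q) → (∀ {x y} → x ∈ p → y ∈ p → f x ≡ f y → x ≡ y) → ∣ p ∣ ≤ ∣ q ∣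
∣p∣≤∣q∣-injectiveOn f {[]} into inj = z≤n
∣p∣≤∣q∣-injectiveOn f {outside ∷ p} into inj =
  ∣p∣≤∣q∣-injectiveOn (f ∘ suc) (into ∘ there)
    (λ x∈p y∈p → suc-injective ∘ inj (there x∈p) (there y∈p))
∣p∣≤∣q∣-injectiveOn f {inside ∷ p} {q} into inj =
  ≤-trans (s≤s (∣p∣≤∣q∣-injectiveOn (f ∘ suc) {p} {q - f zero} into-rest inj-rest))
          (x∈p⇒∣p-x∣<∣p∣ (into here))
  where
  into-rest : ∀ {x} → x ∈ p → f (suc x) ∈ q - f zero
  into-rest x∈p = x∈p∧x≢y⇒x∈p-y (into (there x∈p)) (0≢1+n ∘ sym ∘ inj (there x∈p) here)
  inj-rest : ∀ {x y} → x ∈ p → y ∈ p → f (suc x) ≡ f (suc y) → x ≡ y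
  inj-rest x∈p y∈p = suc-injective ∘ inj (there x∈p) (there y∈p)

∈-allSubsets : (p : Subset m) → p List.∈ allSubsets m
∈-allSubsets []            = Any.here refl
∈-allSubsets (true ∷ p)    = ∈-++⁺ˡ (∈-map⁺ (true ∷_) (∈-allSubsets p))
∈-allSubsets {suc m} (false ∷ p) =
  ∈-++⁺ʳ (map (true ∷_) (allSubsets m)) (∈-map⁺ (false ∷_) (∈-allSubsets p))

independentSize : (G : Graph) → Subset (n G) → ℕ
independentSize G p = if isIndependent G p then ∣ p ∣ else 0

isIndependent⇒∣p∣≤α : (G : Graph) (p : Subset (n G)) → T (isIndependent G p) → ∣ p ∣ ≤ α G
isIndependent⇒∣p∣≤α G p ind =
  foldr-preservesᵒ ≤-⊔ 0 _ (inj₂ (Any.map⁺ (List.lose (∈-allSubsets p) size≤)))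
  where
  ≤-⊔ : ∀ a b → ∣ p ∣ ≤ a ⊎ ∣ p ∣ ≤ b → ∣ p ∣ ≤ a ⊔ b
  ≤-⊔ a b = [ (λ h → ≤-trans h (m≤m⊔n a b)) , (λ h → ≤-trans h (m≤n⊔m a b)) ]′
  size≤ : ∣ p ∣ ≤ independentSize G p
  size≤ rewrite Equivalence.to T-≡ ind = ≤-refl

α-lub : (G : Graph) {b : ℕ} → (∀ p → T (isIndependent G p) → ∣ p ∣ ≤ b) → α G ≤ b
α-lub G {b} bounded =
  foldr-preservesᵇ {P = _≤ b} ⊔-lub z≤n (All.map⁺ (All.universal size≤ (allSubsets (n G))))
  where
  size≤ : ∀ p → independentSize G p ≤ b
  size≤ p with isIndependent G p in ind
  ... | true  = bounded p (Equivalence.from T-≡ ind)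
  ... | false = z≤n

module _ (h : ComplementHom G K) {p : Subset (n G)} (ind : Independent G p) where

  ComplementHom-injectiveOn : ∀ {x y} → x ∈ p → y ∈ p → to h x ≡ to h y → x ≡ y
  ComplementHom-injectiveOn x∈p y∈p hx≡hy =
    ind x∈p y∈p (reflects h (subst (λ z → T (closedAdj K (to h _) z)) hx≡hy (closedAdj-refl K _)))

  image-Independent : Independent K (image (to h) p)
  image-Independent y∈ y′∈ y~y′ with ∈-image⁻ (to h) p y∈ | ∈-image⁻ (to h) p y′∈
  ... | x , x∈p , refl | x′ , x′∈p , refl = cong (to h) (ind x∈p x′∈p (reflects h y~y′))

α-mono : ComplementHom G K → α G ≤ α K
α-mono {G} {K} h = α-lub G λ p ind →
  let ind′ = isIndependent⇒Independent G p ind in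
  ≤-trans (∣p∣≤∣q∣-injectiveOn (to h) {p} (∈-image⁺ (to h)) (ComplementHom-injectiveOn h ind′))
          (isIndependent⇒∣p∣≤α K (image (to h) p)
            (Independent⇒isIndependent K _ (image-Independent h ind′)))

α-⊠-mono : Expand K G → (W : Graph) → α (G ⊠ W) ≤ α (K ⊠ W)
α-⊠-mono e W = α-mono (⊠-complementHom (Expand⇒ComplementHom e) W)

AlphaStarLe-mono : {A B C D : Graph} →
  (∀ W → α (A ⊠ W) ≤ α (C ⊠ W)) → (∀ W → α (D ⊠ W) ≤ α (B ⊠ W)) → AlphaStarLe A B C D
AlphaStarLe-mono A≤C D≤B W p q p<A =
  W , ≤-<-trans (*-monoʳ-≤ p (D≤B W)) (<-≤-trans p<A (*-monoˡ-≤ (suc q) (A≤C W)))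

lemma4 : (G G′ H H′ : Graph) → Expand G G′ → Expand H H′ →
    AlphaStarLe G′ H G H × AlphaStarLe G H G H′
lemma4 G G′ H H′ eG eH =
    AlphaStarLe-mono {G′} {H} {G} {H} (α-⊠-mono eG) (λ _ → ≤-refl)
  , AlphaStarLe-mono {G} {H} {G} {H′} (λ _ → ≤-refl) (α-⊠-mono eH)
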